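{- Let $G$ be a graph without isolated vertices, let $Y$ be a uniform NFBDD realizing $\phi(G)$, and let $a$ be a node of $Y$. Then the total weight of the set of all paths from $a$ to the leaf of $Y$ equals $1$.
   Context: $\phi(G)$ is the monotone 2-CNF with variables $\{x_v: v\in V(G)\}$ and clauses $(x_u\vee x_v)$ for $\{u,v\}\in E(G)$. An NROBP realizing $F$ is a connected DAG (multiple edges allowed) with one root and one leaf, some edges labelled by literals, no directed path containing two edges labelled by literals of the same variable; with $A(P)$ the literals on $P$, every extension of $A(P)$ for a root-to-leaf $P$ satisfies $F$ and every satisfying assignment contains some such $A(P)$. Uniform: paths from the root to the same node carry literals of the same variable set, and root-to-leaf paths carry literals of all variables. An NFBDD is an NROBP in which every edge is labelled, every node has out-degree at most $2$, and the two out-edges of a node of out-degree $2$ are labelled by opposite literals of the same variable. Weights: an out-edge of a node with two out-edges has weight $1/2$; the out-edge of a node with one out-edge has weight $1$; a path has weight equal to the product of its edge weights (weight $1$ if it consists of a single node); a set of paths has weight equal to the sum of the weights of its members. -}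

module Defs where

open import Data.Nat using (ℕ; zero; suc)
open import Data.Bool using (Bool; true; false; T)
open import Data.Fin using (Fin)
open import Data.Fin.Properties using (_≟_)
open import Data.List using (List; []; _∷_; map; length; filter; foldr; concatMap; [_])
open import Data.List.Membership.Propositional using (_∈_)
open import Data.List.Relation.Unary.All using (All)
open import Data.List.Relation.Unary.Any using (Any)
import Data.List.Relation.Unary.Unique.Propositional as U
open import Data.List.Base using (allFin)
open import Data.Maybe using (Maybe; just; nothing)
open import Data.Product using (Σ; ∃; _×_; _,_)
open import Data.Sum using (_⊎_)
open import Data.Rational using (ℚ; ½; 1ℚ; 0ℚ; _+_; _*_)
open import Relation.Binary.PropositionalEquality using (_≡_; _≢_)
open import Relation.Nullary using (¬_)
open import Function.Bundles using (_⇔_)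

record Graph (n : ℕ) : Set where
  field
    adj   : Fin n → Fin n → Bool
    sym   : ∀ u v → adj u v ≡ adj v u
    irrefl : ∀ v → adj v v ≡ false
open Graph public

NoIsolatedVertices : ∀ {n} → Graph n → Set
NoIsolatedVertices {n} G = ∀ (v : Fin n) → ∃ λ (u : Fin n) → adj G v u ≡ true

-- literals over variables x_0 … x_{n-1}: polarity true = x_v, false = ¬x_v
record Literal (n : ℕ) : Set where
  constructor lit
  field
    var : Fin n
    pol : Bool
open Literal public

Assignment : ℕ → Set
Assignment n = Fin n → Bool

LitTrue : ∀ {n} → Assignment n → Literal n → Set
LitTrue σ ℓ = σ (var ℓ) ≡ pol ℓ

CNF : ℕ → Set
CNF n = List (List (Literal n))

Satisfies : ∀ {n} → Assignment n → CNF n → Set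
Satisfies σ F = All (λ C → Any (LitTrue σ) C) F

-- φ(G): clause (x_u ∨ x_v) for every edge {u,v} (listed for both orientations)
φ : ∀ {n} → Graph n → CNF n
φ {n} G = concatMap (λ u → concatMap (λ v → clause u v (adj G u v)) (allFin n)) (allFin n)
  where
  clause : Fin n → Fin n → Bool → CNF n
  clause u v true  = [ lit u true ∷ lit v true ∷ [] ]
  clause u v false = []

record Diagram (n : ℕ) : Set where
  field
    nodes edges : ℕ
    src tgt : Fin edges → Fin nodes
    lab     : Fin edges → Maybe (Literal n)
    root leaf : Fin nodes
open Diagram public

module _ {n : ℕ} (D : Diagram n) where

  Node : Set
  Node = Fin (nodes D)

  data Path : Node → Node → Set where
    nil  : (u : Node) → Path u u
    cons : (e : Fin (edges D)) {v : Node} → Path (tgt D e) v → Path (src D e) v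

  data UWalk : Node → Node → Set where
    unil : (u : Node) → UWalk u u
    fwd  : (e : Fin (edges D)) {v : Node} → UWalk (tgt D e) v → UWalk (src D e) v
    bwd  : (e : Fin (edges D)) {v : Node} → UWalk (src D e) v → UWalk (tgt D e) v

  labels : ∀ {u v} → Path u v → List (Literal n)
  labels (nil _) = []
  labels (cons e p) with lab D e
  ... | just ℓ  = ℓ ∷ labels p
  ... | nothing = labels p

  vars : ∀ {u v} → Path u v → List (Fin n)
  vars p = map var (labels p)

  IsSource IsSink : Node → Set
  IsSource u = ∀ e → tgt D e ≢ u
  IsSink   u = ∀ e → src D e ≢ u

  outEdges : Node → List (Fin (edges D))
  outEdges u = filter (λ e → src D e ≟ u) (allFin (edges D))

  outdeg : Node → ℕ
  outdeg u = length (outEdges u)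

  Acyclic : Set
  Acyclic = ∀ (u : Node) (p : Path u u) → p ≡ nil u

  Connected : Set
  Connected = ∀ (u v : Node) → UWalk u v

  ReadOnce : Set
  ReadOnce = ∀ (u v : Node) (p : Path u v) → U.Unique (vars p)

  Realizes : CNF n → Set
  Realizes F =
    (∀ (p : Path (root D) (leaf D)) (σ : Assignment n) →
        All (LitTrue σ) (labels p) → Satisfies σ F)
    × (∀ (σ : Assignment n) → Satisfies σ F →
        ∃ λ (p : Path (root D) (leaf D)) → All (LitTrue σ) (labels p))

  IsNROBP : CNF n → Set
  IsNROBP F =
    Acyclic × Connected
    × (IsSource (root D) × (∀ u → IsSource u → u ≡ root D))
    × (IsSink (leaf D) × (∀ u → IsSink u → u ≡ leaf D))
    × ReadOnce × Realizes F

  Uniform : Set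
  Uniform =
    (∀ (u : Node) (p q : Path (root D) u) → ∀ (x : Fin n) → (x ∈ vars p) ⇔ (x ∈ vars q))
    × (∀ (p : Path (root D) (leaf D)) (x : Fin n) → x ∈ vars p)

  Opposite : Literal n → Literal n → Set
  Opposite ℓ ℓ' = (var ℓ ≡ var ℓ') × (pol ℓ ≢ pol ℓ')

  IsNFBDD : CNF n → Set
  IsNFBDD F =
    IsNROBP F
    × (∀ e → ∃ λ ℓ → lab D e ≡ just ℓ)
    × (∀ (u : Node) → outdeg u Data.Nat.≤ 2)
    × (∀ (e e' : Fin (edges D)) → e ≢ e' → src D e ≡ src D e' →
         ∃ λ ℓ → ∃ λ ℓ' → lab D e ≡ just ℓ × lab D e' ≡ just ℓ' × Opposite ℓ ℓ')

  edgeWeight : Fin (edges D) → ℚ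
  edgeWeight e with outdeg (src D e)
  ... | 2 = ½
  ... | _ = 1ℚ

  pathWeight : ∀ {u v} → Path u v → ℚ
  pathWeight (nil _)    = 1ℚ
  pathWeight (cons e p) = edgeWeight e * pathWeight p

  Enumerates : (u v : Node) → List (Path u v) → Set
  Enumerates u v L = (∀ (p : Path u v) → p ∈ L) × U.Unique L

  setWeight : ∀ {u v} → List (Path u v) → ℚ
  setWeight L = foldr (λ p w → pathWeight p + w) 0ℚ L

  TotalWeightOfAllPaths : (u v : Node) → ℚ → Set
  TotalWeightOfAllPaths u v w =
    (∃ λ L → Enumerates u v L)
    × (∀ L → Enumerates u v L → setWeight L ≡ w)

-- Every node other than the leaf has either one out-edge, of weight 1, or two, of
-- weight ½ each, so the weights of its out-edges sum to 1. Splitting a path at its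
-- first edge, the weight of all paths from a to the leaf is therefore 1 by induction
-- on the length of the longest path from a, which is finite because the diagram is
-- acyclic.
module Submission where

open import Defs hiding (sym)
open import Data.Nat using (ℕ; zero; suc; _≤_; s≤s)
open import Data.Nat.Properties using (≤-pred)
open import Data.Rational using (ℚ; ½; 1ℚ; 0ℚ; _+_; _*_)
import Data.Rational.Properties as ℚ
open import Data.Fin using (Fin; zero; suc)
open import Data.Fin.Properties using (_≟_; injective⇒≤)
open import Data.List using (List; []; _∷_; [_]; map; length; filter; foldr; _++_)
open import Data.List.Base using (allFin)
open import Data.List.Properties using (foldr-map)
open import Data.List.Membership.Propositional using (_∈_)
open import Data.List.Membership.Propositional.Properties
  using (∈-map⁺; ∈-map⁻; ∈-++⁺ˡ; ∈-++⁺ʳ; ∈-++⁻; ∈-allFin; ∈-filter⁺)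
open import Data.List.Membership.Propositional.Properties.WithK using (unique∧set⇒bag)
open import Data.List.Relation.Unary.All as All using (All)
open import Data.List.Relation.Unary.All.Properties using (all-filter)
open import Data.List.Relation.Unary.Any using (here; there)
open import Data.List.Relation.Unary.AllPairs using ([]; _∷_)
open import Data.List.Relation.Unary.Unique.Propositional using (Unique)
import Data.List.Relation.Unary.Unique.Propositional.Properties as Unique
open import Data.List.Relation.Binary.Disjoint.Propositional using (Disjoint)
open import Data.List.Relation.Binary.Permutation.Propositional using (_↭_; ↭⇒↭ₛ)
import Data.List.Relation.Binary.Permutation.Propositional.Properties as ↭
open import Data.List.Relation.Binary.Permutation.Setoid.Properties using (foldr-commMonoid)
open import Data.List.Relation.Binary.BagAndSetEquality using (∼bag⇒↭)
open import Data.Maybe using (Maybe; just; nothing)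
open import Data.Product using (∃; _×_; _,_)
open import Data.Sum using (inj₁; inj₂)
open import Data.Empty using (⊥-elim)
open import Function.Bundles using (mk⇔)
open import Function.Definitions using (Injective)
open import Relation.Binary.PropositionalEquality
  using (_≡_; _≢_; refl; sym; trans; cong; cong₂; subst; setoid; module ≡-Reasoning)
open import Relation.Nullary using (¬_; yes; no)

sum-↭ : ∀ {xs ys : List ℚ} → xs ↭ ys → foldr _+_ 0ℚ xs ≡ foldr _+_ 0ℚ ys
sum-↭ xs↭ys = foldr-commMonoid (setoid ℚ) ℚ.+-0-isCommutativeMonoid (↭⇒↭ₛ xs↭ys)

branchWeight : ℕ → ℚ
branchWeight 2 = ½
branchWeight _ = 1ℚ

module _ {n : ℕ} (D : Diagram n) where

  pathLength : ∀ {u v} → Path D u v → ℕ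
  pathLength (nil _)    = 0
  pathLength (cons _ p) = suc (pathLength p)

  vertexAt : ∀ {u v} (p : Path D u v) → Fin (pathLength p) → Node D
  vertexAt (cons e _) zero    = src D e
  vertexAt (cons _ p) (suc i) = vertexAt p i

  initialSegment : ∀ {u v} (p : Path D u v) (i : Fin (pathLength p)) → Path D u (vertexAt p i)
  initialSegment (cons e _) zero    = nil (src D e)
  initialSegment (cons e p) (suc i) = cons e (initialSegment p i)

  firstEdge : ∀ {u v} → Path D u v → Maybe (Fin (edges D))
  firstEdge (nil _)    = nothing
  firstEdge (cons e _) = just e

  cons-injective : ∀ {e v} {q q′ : Path D (tgt D e) v} → cons e q ≡ cons e q′ → q ≡ q′
  cons-injective refl = refl

  module _ (acyclic : Acyclic D) where

    no-return : ∀ e → ¬ Path D (tgt D e) (src D e)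
    no-return e p with acyclic (src D e) (cons e p)
    ... | ()

    vertexAt-injective : ∀ {u v} (p : Path D u v) → Injective _≡_ _≡_ (vertexAt p)
    vertexAt-injective (cons e p) {zero}  {zero}  _  = refl
    vertexAt-injective (cons e p) {zero}  {suc j} eq =
      ⊥-elim (no-return e (subst (Path D (tgt D e)) (sym eq) (initialSegment p j)))
    vertexAt-injective (cons e p) {suc i} {zero}  eq =
      ⊥-elim (no-return e (subst (Path D (tgt D e)) eq (initialSegment p i)))
    vertexAt-injective (cons e p) {suc i} {suc j} eq = cong suc (vertexAt-injective p eq)

    pathLength≤nodes : ∀ {u v} (p : Path D u v) → pathLength p ≤ nodes D
    pathLength≤nodes p = injective⇒≤ (vertexAt-injective p)

  setWeight-++ : ∀ {u v} (ps qs : List (Path D u v)) →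
                 setWeight D (ps ++ qs) ≡ setWeight D ps + setWeight D qs
  setWeight-++ []       qs = sym (ℚ.+-identityˡ (setWeight D qs))
  setWeight-++ (p ∷ ps) qs = begin
    pathWeight D p + setWeight D (ps ++ qs)                ≡⟨ cong (pathWeight D p +_) (setWeight-++ ps qs) ⟩
    pathWeight D p + (setWeight D ps + setWeight D qs)     ≡⟨ ℚ.+-assoc (pathWeight D p) _ _ ⟨
    pathWeight D p + setWeight D ps + setWeight D qs       ∎
    where open ≡-Reasoning

  setWeight-map-cons : ∀ e {v} (qs : List (Path D (tgt D e) v)) →
                       setWeight D (map (cons e) qs) ≡ edgeWeight D e * setWeight D qs
  setWeight-map-cons e []       = sym (ℚ.*-zeroʳ (edgeWeight D e))
  setWeight-map-cons e (q ∷ qs) = begin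
    edgeWeight D e * pathWeight D q + setWeight D (map (cons e) qs)
      ≡⟨ cong (edgeWeight D e * pathWeight D q +_) (setWeight-map-cons e qs) ⟩
    edgeWeight D e * pathWeight D q + edgeWeight D e * setWeight D qs
      ≡⟨ ℚ.*-distribˡ-+ (edgeWeight D e) (pathWeight D q) (setWeight D qs) ⟨
    edgeWeight D e * (pathWeight D q + setWeight D qs) ∎
    where open ≡-Reasoning

  setWeight-↭ : ∀ {u v} {ps qs : List (Path D u v)} → ps ↭ qs → setWeight D ps ≡ setWeight D qs
  setWeight-↭ {ps = ps} {qs} ps↭qs = begin
    setWeight D ps                      ≡⟨ foldr-map _+_ (pathWeight D) 0ℚ ps ⟨
    foldr _+_ 0ℚ (map (pathWeight D) ps) ≡⟨ sum-↭ (↭.map⁺ (pathWeight D) ps↭qs) ⟩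
    foldr _+_ 0ℚ (map (pathWeight D) qs) ≡⟨ foldr-map _+_ (pathWeight D) 0ℚ qs ⟩
    setWeight D qs                      ∎
    where open ≡-Reasoning

  Enumerates-↭ : ∀ {u v} {ps qs : List (Path D u v)} →
                 Enumerates D u v ps → Enumerates D u v qs → ps ↭ qs
  Enumerates-↭ (∈ps , ps!) (∈qs , qs!) =
    ∼bag⇒↭ (unique∧set⇒bag ps! qs! (mk⇔ (λ _ → ∈qs _) (λ _ → ∈ps _)))

  Enumerates⇒TotalWeight : ∀ {u v w} {ps : List (Path D u v)} →
                           Enumerates D u v ps → setWeight D ps ≡ w → TotalWeightOfAllPaths D u v w
  Enumerates⇒TotalWeight ps-enum ps≡w =
    (_ , ps-enum) , λ qs qs-enum → trans (sym (setWeight-↭ (Enumerates-↭ ps-enum qs-enum))) ps≡w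

  edgesWeight : List (Fin (edges D)) → ℚ
  edgesWeight = foldr (λ e w → edgeWeight D e + w) 0ℚ

  edgesFrom : Node D → List (Fin (edges D)) → List (Fin (edges D))
  edgesFrom u = filter (λ e → src D e ≟ u)

  outEdge-of-weight≢0 : ∀ u es → edgesWeight (edgesFrom u es) ≢ 0ℚ → ∃ λ e → src D e ≡ u
  outEdge-of-weight≢0 u []       w≢0 = ⊥-elim (w≢0 refl)
  outEdge-of-weight≢0 u (e ∷ es) w≢0 with src D e ≟ u
  ... | yes e-from-u = e , e-from-u
  ... | no _         = outEdge-of-weight≢0 u es w≢0

  outEdges-[]⇒IsSink : ∀ u → outEdges D u ≡ [] → IsSink D u
  outEdges-[]⇒IsSink u empty e e-from-u
    with subst (e ∈_) empty (∈-filter⁺ (λ e → src D e ≟ u) (∈-allFin e) e-from-u)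
  ... | ()

  edgeWeight≡branchWeight : ∀ e → edgeWeight D e ≡ branchWeight (outdeg D (src D e))
  edgeWeight≡branchWeight e with outdeg D (src D e)
  ... | 0                 = refl
  ... | 1                 = refl
  ... | 2                 = refl
  ... | suc (suc (suc _)) = refl

  edgesWeight-branching : ∀ es → All (λ e → edgeWeight D e ≡ branchWeight (length es)) es →
                          es ≢ [] → length es ≤ 2 → edgesWeight es ≡ 1ℚ
  edgesWeight-branching []              _                     es≢[] _ = ⊥-elim (es≢[] refl)
  edgesWeight-branching (_ ∷ [])        (w₁ All.∷ _)          _     _ = cong (_+ 0ℚ) w₁
  edgesWeight-branching (_ ∷ _ ∷ [])    (w₁ All.∷ w₂ All.∷ _) _     _ = cong₂ (λ x y → x + (y + 0ℚ)) w₁ w₂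
  edgesWeight-branching (_ ∷ _ ∷ _ ∷ _) _                     _     (s≤s (s≤s ()))

  outEdgesWeight≡1 : (∀ u → IsSink D u → u ≡ leaf D) → (∀ u → outdeg D u ≤ 2) →
                     ∀ u → u ≢ leaf D → edgesWeight (outEdges D u) ≡ 1ℚ
  outEdgesWeight≡1 sinks≡leaf outdeg≤2 u u≢leaf =
    edgesWeight-branching (outEdges D u)
      (All.map (λ { refl → edgeWeight≡branchWeight _ }) (all-filter (λ e → src D e ≟ u) (allFin _)))
      (λ empty → u≢leaf (sinks≡leaf u (outEdges-[]⇒IsSink u empty)))
      (outdeg≤2 u)

  module _ (v : Node D) where

    trivialPaths : (u : Node D) → List (Path D u v)
    trivialPaths u with u ≟ v
    ... | yes refl = [ nil v ]
    ... | no _     = []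

    mutual
      pathsWithin : ℕ → (u : Node D) → List (Path D u v)
      pathsWithin zero    u = trivialPaths u
      pathsWithin (suc k) u = trivialPaths u ++ pathsVia k u (allFin (edges D))

      pathsVia : ℕ → (u : Node D) → List (Fin (edges D)) → List (Path D u v)
      pathsVia k u []       = []
      pathsVia k u (e ∷ es) with src D e ≟ u
      ... | yes refl = map (cons e) (pathsWithin k (tgt D e)) ++ pathsVia k (src D e) es
      ... | no _     = pathsVia k u es

    nil∈trivialPaths : nil v ∈ trivialPaths v
    nil∈trivialPaths with v ≟ v
    ... | yes refl = here refl
    ... | no v≢v   = ⊥-elim (v≢v refl)

    ∈-pathsVia : ∀ k e {q : Path D (tgt D e) v} → q ∈ pathsWithin k (tgt D e) →
                 ∀ {u es} (e-from-u : src D e ≡ u) → e ∈ es →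
                 subst (λ x → Path D x v) e-from-u (cons e q) ∈ pathsVia k u es
    ∈-pathsVia k e q∈ {es = e ∷ es} refl (here refl) with src D e ≟ src D e
    ... | yes refl = ∈-++⁺ˡ (∈-map⁺ (cons e) q∈)
    ... | no e≢e   = ⊥-elim (e≢e refl)
    ∈-pathsVia k e q∈ {u} {e′ ∷ es} e-from-u (there e∈es) with src D e′ ≟ u
    ... | yes refl = ∈-++⁺ʳ _ (∈-pathsVia k e q∈ e-from-u e∈es)
    ... | no _     = ∈-pathsVia k e q∈ e-from-u e∈es

    ∈-pathsWithin : ∀ k {u} (p : Path D u v) → pathLength p ≤ k → p ∈ pathsWithin k u
    ∈-pathsWithin zero    (nil _)    _ = nil∈trivialPaths
    ∈-pathsWithin (suc k) (nil _)    _ = ∈-++⁺ˡ nil∈trivialPaths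
    ∈-pathsWithin (suc k) (cons e q) (s≤s q≤k) =
      ∈-++⁺ʳ (trivialPaths _) (∈-pathsVia k e (∈-pathsWithin k q q≤k) refl (∈-allFin e))

    trivialPaths-unique : ∀ u → Unique (trivialPaths u)
    trivialPaths-unique u with u ≟ v
    ... | yes refl = All.[] ∷ []
    ... | no _     = []

    firstEdge-trivialPaths : ∀ {u p} → p ∈ trivialPaths u → firstEdge p ≡ nothing
    firstEdge-trivialPaths {u} p∈ with u ≟ v
    firstEdge-trivialPaths (here refl) | yes refl = refl

    firstEdge-pathsVia : ∀ k u es {p} → p ∈ pathsVia k u es → ∃ λ e → firstEdge p ≡ just e × e ∈ es
    firstEdge-pathsVia k u (e ∷ es) p∈ with src D e ≟ u
    ... | no _ = let e′ , first≡e′ , e′∈es = firstEdge-pathsVia k u es p∈ in e′ , first≡e′ , there e′∈es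
    ... | yes refl with ∈-++⁻ (map (cons e) (pathsWithin k (tgt D e))) p∈
    ...   | inj₂ p∈es = let e′ , first≡e′ , e′∈es = firstEdge-pathsVia k (src D e) es p∈es in
                        e′ , first≡e′ , there e′∈es
    ...   | inj₁ p∈e with ∈-map⁻ (cons e) p∈e
    ...     | _ , _ , refl = e , refl , here refl

    mutual
      pathsWithin-unique : ∀ k u → Unique (pathsWithin k u)
      pathsWithin-unique zero    u = trivialPaths-unique u
      pathsWithin-unique (suc k) u =
        Unique.++⁺ (trivialPaths-unique u) (pathsVia-unique k u (Unique.allFin⁺ _)) disjoint
        where
        disjoint : Disjoint (trivialPaths u) (pathsVia k u (allFin (edges D)))
        disjoint (p∈trivial , p∈via) with firstEdge-pathsVia k u (allFin (edges D)) p∈via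
        ... | _ , first≡just , _ with trans (sym (firstEdge-trivialPaths p∈trivial)) first≡just
        ...   | ()

      pathsVia-unique : ∀ k u {es} → Unique es → Unique (pathsVia k u es)
      pathsVia-unique k u {[]}     _             = []
      pathsVia-unique k u {e ∷ es} (e∉es ∷ es!) with src D e ≟ u
      ... | no _     = pathsVia-unique k u es!
      ... | yes refl =
        Unique.++⁺ (Unique.map⁺ cons-injective (pathsWithin-unique k (tgt D e)))
                   (pathsVia-unique k (src D e) es!) disjoint
        where
        disjoint : Disjoint (map (cons e) (pathsWithin k (tgt D e))) (pathsVia k (src D e) es)
        disjoint (p∈e , p∈es) with ∈-map⁻ (cons e) p∈e
        ... | _ , _ , refl with firstEdge-pathsVia k (src D e) es p∈es
        ...   | _ , refl , e∈es = All.lookup e∉es e∈es refl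

    pathsVia-IsSink : ∀ k {u} → IsSink D u → ∀ es → pathsVia k u es ≡ []
    pathsVia-IsSink k     sink []       = refl
    pathsVia-IsSink k {u} sink (e ∷ es) with src D e ≟ u
    ... | yes e-from-u = ⊥-elim (sink e e-from-u)
    ... | no _         = pathsVia-IsSink k sink es

    setWeight-pathsVia : ∀ k u → (∀ e → src D e ≡ u → setWeight D (pathsWithin k (tgt D e)) ≡ 1ℚ) →
                         ∀ es → setWeight D (pathsVia k u es) ≡ edgesWeight (edgesFrom u es)
    setWeight-pathsVia k u tails≡1 []       = refl
    setWeight-pathsVia k u tails≡1 (e ∷ es) with src D e ≟ u
    ... | no _     = setWeight-pathsVia k u tails≡1 es
    ... | yes refl = begin
      setWeight D (map (cons e) tails ++ pathsVia k (src D e) es)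
        ≡⟨ setWeight-++ (map (cons e) tails) (pathsVia k (src D e) es) ⟩
      setWeight D (map (cons e) tails) + setWeight D (pathsVia k (src D e) es)
        ≡⟨ cong₂ _+_ (setWeight-map-cons e tails) (setWeight-pathsVia k (src D e) tails≡1 es) ⟩
      edgeWeight D e * setWeight D tails + rest
        ≡⟨ cong (λ w → edgeWeight D e * w + rest) (tails≡1 e refl) ⟩
      edgeWeight D e * 1ℚ + rest
        ≡⟨ cong (_+ rest) (ℚ.*-identityʳ (edgeWeight D e)) ⟩
      edgeWeight D e + rest ∎
      where
      open ≡-Reasoning
      tails = pathsWithin k (tgt D e)
      rest  = edgesWeight (edgesFrom (src D e) es)

    module _ (v-sink : IsSink D v) (stochastic : ∀ u → u ≢ v → edgesWeight (outEdges D u) ≡ 1ℚ) where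

      setWeight-pathsWithin : ∀ k u → (∀ {w} (p : Path D u w) → pathLength p ≤ k) →
                              setWeight D (pathsWithin k u) ≡ 1ℚ
      setWeight-pathsWithin zero u short with u ≟ v
      ... | yes refl = refl
      ... | no u≢v
        with outEdge-of-weight≢0 u (allFin (edges D)) (λ w≡0 → ℚ.1≢0 (trans (sym (stochastic u u≢v)) w≡0))
      ...   | e , refl with short (cons e (nil (tgt D e)))
      ...     | ()
      setWeight-pathsWithin (suc k) u short with u ≟ v
      ... | yes refl = cong (λ ps → setWeight D (nil v ∷ ps)) (pathsVia-IsSink k v-sink (allFin (edges D)))
      ... | no u≢v   = trans (setWeight-pathsVia k u tails≡1 (allFin (edges D))) (stochastic u u≢v)
        where
        tails≡1 : ∀ e → src D e ≡ u → setWeight D (pathsWithin k (tgt D e)) ≡ 1ℚ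
        tails≡1 e refl = setWeight-pathsWithin k (tgt D e) (λ p → ≤-pred (short (cons e p)))

      allPaths-weight≡1 : Acyclic D → ∀ a → TotalWeightOfAllPaths D a v 1ℚ
      allPaths-weight≡1 acyclic a =
        Enumerates⇒TotalWeight
          ((λ p → ∈-pathsWithin (nodes D) p (pathLength≤nodes acyclic p)) , pathsWithin-unique (nodes D) a)
          (setWeight-pathsWithin (nodes D) a (pathLength≤nodes acyclic))

proposition2 : ∀ {n : ℕ} (G : Graph n) → NoIsolatedVertices G →
    (Y : Diagram n) → Uniform Y → IsNFBDD Y (φ G) →
    (a : Node Y) → TotalWeightOfAllPaths Y a (leaf Y) 1ℚ
proposition2 G _ Y _ ((acyclic , _ , _ , (leaf-sink , sinks≡leaf) , _ , _) , _ , outdeg≤2 , _) =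
  allPaths-weight≡1 Y (leaf Y) leaf-sink (outEdgesWeight≡1 Y sinks≡leaf outdeg≤2) acyclic
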